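{- Let $G=S_{m_1}^-\boxtimes\cdots\boxtimes S_{m_p}^-\boxtimes S_{n_1}^+\boxtimes\cdots\boxtimes S_{n_q}^+$ with a $c$-coloring $c$. Then $G$ has an up-color kernel if and only if the set $\{(0,\dots,0,x_1,\dots,x_q)\in V(G): x_i\neq 0 \text{ for all } i\}$ (whose first $p$ coordinates are $0$; this is the set of vertices of $G$ of out-degree $0$) is up-color absorbent.
   Context: $S_k^+$ is the orientation of the star $K_{1,k}$ in which all arcs go from the center to the leaves, and $S_k^-$ the orientation in which all arcs go from the leaves to the center. In each star the center is labeled $0$ and the leaves $1,\dots,k$, so vertices of the product are tuples of labels. The strong product $D_1\boxtimes D_2$ has vertex set $V(D_1)\times V(D_2)$ and an arc from $(x,y)$ to $(z,w)$ iff either $x=z$ and $(y,w)\in A(D_2)$, or $y=w$ and $(x,z)\in A(D_1)$, or $(x,z)\in A(D_1)$ and $(y,w)\in A(D_2)$ (iterated coordinatewise). A $c$-coloring is a function $c:V(G)\to\{0,1,2,\ldots\}$. A set $N$ is up-color absorbent if every vertex $v\notin N$ has an out-neighbor $w\in N$ with $c(v)<c(w)$, and no vertex of $N$ has color $0$; an up-color kernel is an independent up-color absorbent set. -}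

module Defs where

open import Data.Nat using (ℕ; suc; _<_; _≤_)
open import Data.Fin using (Fin; zero)
open import Data.Bool using (Bool; true)
open import Data.Product using (Σ; _×_; ∃)
open import Data.Sum using (_⊎_)
open import Relation.Nullary using (¬_)
open import Relation.Binary.PropositionalEquality using (_≡_; _≢_)

-- Star K_{1,k}: vertex set Fin (suc k), center = zero, leaves = 1..k.
-- S_k^+ : arcs center → leaf.
OutStarArc : ∀ {k} → Fin (suc k) → Fin (suc k) → Set
OutStarArc x y = (x ≡ zero) × (y ≢ zero)

InStarArc : ∀ {k} → Fin (suc k) → Fin (suc k) → Set
InStarArc x y = (x ≢ zero) × (y ≡ zero)

-- Vertices of G = S_{m_1}^- ⊠ ... ⊠ S_{m_p}^- ⊠ S_{n_1}^+ ⊠ ... ⊠ S_{n_q}^+ :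
-- a tuple of p labels for the in-stars followed by q labels for the out-stars.
Vertex : (p q : ℕ) (m : Fin p → ℕ) (n : Fin q → ℕ) → Set
Vertex p q m n = ((i : Fin p) → Fin (suc (m i))) × ((j : Fin q) → Fin (suc (n j)))

Arc : ∀ {p q m n} → Vertex p q m n → Vertex p q m n → Set
Arc {p} {q} (u₁ Data.Product., u₂) (v₁ Data.Product., v₂) =
  ((i : Fin p) → (u₁ i ≡ v₁ i) ⊎ InStarArc (u₁ i) (v₁ i)) ×
  ((j : Fin q) → (u₂ j ≡ v₂ j) ⊎ OutStarArc (u₂ j) (v₂ j)) ×
  ¬ (((i : Fin p) → u₁ i ≡ v₁ i) × ((j : Fin q) → u₂ j ≡ v₂ j))

module _ {p q : ℕ} {m : Fin p → ℕ} {n : Fin q → ℕ}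
         (c : Vertex p q m n → ℕ) where

  UpColorAbsorbent : (Vertex p q m n → Set) → Set
  UpColorAbsorbent N =
    (∀ v → ¬ N v → Σ (Vertex p q m n) (λ w → Arc v w × N w × (c v < c w))) ×
    (∀ v → N v → c v ≢ 0)

  Independent : (Vertex p q m n → Bool) → Set
  Independent N = ∀ u v → N u ≡ true → N v ≡ true → ¬ Arc u v

  HasUpColorKernel : Set
  HasUpColorKernel = Σ (Vertex p q m n → Bool) (λ N →
    Independent N × UpColorAbsorbent (λ v → N v ≡ true))

SinkSet : ∀ {p q m n} → Vertex p q m n → Set
SinkSet {p} {q} (u₁ Data.Product., u₂) =
  ((i : Fin p) → u₁ i ≡ zero) × ((j : Fin q) → u₂ j ≢ zero)

{-# OPTIONS --safe #-}
-- The sinks of G are exactly the vertices of SinkSet, and every other vertex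
-- has an arc into a sink: move every in-star coordinate to its centre and
-- every out-star coordinate at a centre to a leaf. An up-color kernel must
-- contain every sink, since a sink has no out-neighbour to be absorbed by, and
-- then by independence it contains no other vertex. So the only candidate
-- kernel is SinkSet itself, which is independent because sinks have no arcs.
module Submission where

open import Defs
open import Data.Nat using (ℕ; suc; _≤_; _<_; s≤s)
open import Data.Fin using (Fin; zero; suc; _≟_)
open import Data.Fin.Properties using (all?)
open import Data.Bool using (Bool; true)
open import Data.Bool.Properties using () renaming (_≟_ to _≟ᵇ_)
open import Data.Product using (Σ; _×_; _,_; proj₁)
open import Data.Sum using (_⊎_; inj₁; inj₂)
open import Function.Base using (_∘_)
open import Function.Bundles using (_⇔_; mk⇔; Equivalence)
open import Relation.Nullary using (¬_; Dec; yes; no; does; contradiction)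
open import Relation.Nullary.Decidable using (_×-dec_; ¬?; dec-true; decidable-stable)
open import Relation.Binary.PropositionalEquality using (_≡_; _≢_; refl; sym; trans)

open Equivalence using (to; from)

dec-true⁻¹ : ∀ {a} {A : Set a} (a? : Dec A) → does a? ≡ true → A
dec-true⁻¹ (yes a) _ = a
dec-true⁻¹ (no _)  ()

inStar-toCentre : ∀ {k} (x : Fin (suc k)) → x ≡ zero ⊎ InStarArc x zero
inStar-toCentre zero    = inj₁ refl
inStar-toCentre (suc x) = inj₂ ((λ ()) , refl)

leafOf : ∀ {k} → 1 ≤ k → Fin (suc k) → Fin (suc k)
leafOf (s≤s _) zero    = suc zero
leafOf (s≤s _) (suc x) = suc x

leafOf≢zero : ∀ {k} (k≥1 : 1 ≤ k) (x : Fin (suc k)) → leafOf k≥1 x ≢ zero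
leafOf≢zero (s≤s _) zero    ()
leafOf≢zero (s≤s _) (suc x) ()

outStar-toLeaf : ∀ {k} (k≥1 : 1 ≤ k) (x : Fin (suc k)) →
                 x ≡ leafOf k≥1 x ⊎ OutStarArc x (leafOf k≥1 x)
outStar-toLeaf (s≤s _) zero    = inj₂ (refl , λ ())
outStar-toLeaf (s≤s _) (suc x) = inj₁ refl

module _ {p q : ℕ} {m : Fin p → ℕ} {n : Fin q → ℕ} where

  SinkSet? : (v : Vertex p q m n) → Dec (SinkSet v)
  SinkSet? (a , b) = all? (λ i → a i ≟ zero) ×-dec all? (λ j → ¬? (b j ≟ zero))

  SinkSet⇒¬Arc : (u v : Vertex p q m n) → SinkSet u → ¬ Arc u v
  SinkSet⇒¬Arc (a , b) (a′ , b′) (a≡0 , b≢0) (arcs₁ , arcs₂ , u≢v) = u≢v (same₁ , same₂)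
    where
    same₁ : ∀ i → a i ≡ a′ i
    same₁ i with arcs₁ i
    ... | inj₁ eq        = eq
    ... | inj₂ (a≢0 , _) = contradiction (a≡0 i) a≢0
    same₂ : ∀ j → b j ≡ b′ j
    same₂ j with arcs₂ j
    ... | inj₁ eq        = eq
    ... | inj₂ (b≡0 , _) = contradiction b≡0 (b≢0 j)

  isSink : Vertex p q m n → Bool
  isSink v = does (SinkSet? v)

  SinkSet⇔isSink : ∀ v → SinkSet v ⇔ (isSink v ≡ true)
  SinkSet⇔isSink v = mk⇔ (dec-true (SinkSet? v)) (dec-true⁻¹ (SinkSet? v))

  module _ (n≥1 : ∀ j → 1 ≤ n j) where

    sinkOf : Vertex p q m n → Vertex p q m n
    sinkOf (a , b) = (λ _ → zero) , (λ j → leafOf (n≥1 j) (b j))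

    sinkOf-SinkSet : ∀ v → SinkSet (sinkOf v)
    sinkOf-SinkSet (a , b) = (λ _ → refl) , (λ j → leafOf≢zero (n≥1 j) (b j))

    ¬SinkSet⇒Arc-sinkOf : ∀ v → ¬ SinkSet v → Arc v (sinkOf v)
    ¬SinkSet⇒Arc-sinkOf (a , b) ¬sink =
      (λ i → inStar-toCentre (a i)) , (λ j → outStar-toLeaf (n≥1 j) (b j)) , v≢sinkOf
      where
      v≢sinkOf : ¬ (((i : Fin p) → a i ≡ zero) × ((j : Fin q) → b j ≡ leafOf (n≥1 j) (b j)))
      v≢sinkOf (a≡0 , b≡leaf) =
        ¬sink (a≡0 , λ j b≡0 → leafOf≢zero (n≥1 j) (b j) (trans (sym (b≡leaf j)) b≡0))

  module _ (c : Vertex p q m n → ℕ) where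

    UpColorAbsorbent-resp-⇔ : {N M : Vertex p q m n → Set} → (∀ v → N v ⇔ M v) →
                              UpColorAbsorbent c N → UpColorAbsorbent c M
    UpColorAbsorbent-resp-⇔ {N} {M} N⇔M (absorbs , ≢0) = absorbs′ , λ v → ≢0 v ∘ from (N⇔M v)
      where
      absorbs′ : ∀ v → ¬ M v → Σ (Vertex p q m n) λ w → Arc v w × M w × c v < c w
      absorbs′ v ¬Mv = let (w , v→w , Nw , cv<cw) = absorbs v (¬Mv ∘ to (N⇔M v))
                       in w , v→w , to (N⇔M w) Nw , cv<cw

    isSink-independent : Independent c isSink
    isSink-independent u v u∈ _ = SinkSet⇒¬Arc u v (from (SinkSet⇔isSink u) u∈)

    module _ {N : Vertex p q m n → Bool} (absorbent : UpColorAbsorbent c (λ v → N v ≡ true)) where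

      SinkSet⊆absorbent : ∀ v → SinkSet v → N v ≡ true
      SinkSet⊆absorbent v sink = decidable-stable (N v ≟ᵇ true) λ v∉N →
        let (w , v→w , _) = proj₁ absorbent v v∉N in SinkSet⇒¬Arc v w sink v→w

      absorbent⊆SinkSet : (∀ j → 1 ≤ n j) → Independent c N → ∀ v → N v ≡ true → SinkSet v
      absorbent⊆SinkSet n≥1 independent v v∈N = decidable-stable (SinkSet? v) λ ¬sink →
        independent v (sinkOf n≥1 v) v∈N (SinkSet⊆absorbent _ (sinkOf-SinkSet n≥1 v))
                    (¬SinkSet⇒Arc-sinkOf n≥1 v ¬sink)

    kernel⇒SinkSet-absorbent : (∀ j → 1 ≤ n j) → HasUpColorKernel c → UpColorAbsorbent c SinkSet
    kernel⇒SinkSet-absorbent n≥1 (N , independent , absorbent) =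
      UpColorAbsorbent-resp-⇔ (λ v → mk⇔ (absorbent⊆SinkSet absorbent n≥1 independent v)
                                         (SinkSet⊆absorbent absorbent v))
                              absorbent

    SinkSet-absorbent⇒kernel : UpColorAbsorbent c SinkSet → HasUpColorKernel c
    SinkSet-absorbent⇒kernel absorbent =
      isSink , isSink-independent , UpColorAbsorbent-resp-⇔ SinkSet⇔isSink absorbent

mainTheorem7 : (p q : ℕ) (m : Fin p → ℕ) (n : Fin q → ℕ) →
    (∀ i → 1 ≤ m i) → (∀ j → 1 ≤ n j) →
    (c : Vertex p q m n → ℕ) →
    HasUpColorKernel c ⇔ UpColorAbsorbent c SinkSet
mainTheorem7 p q m n _ n≥1 c = mk⇔ (kernel⇒SinkSet-absorbent c n≥1) (SinkSet-absorbent⇒kernel c)
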